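{- Let $\mathcal{F}$ be a family of subsets of $[n]$, let $T\subseteq[n]$ with $|T|=t$, and let $\mathcal{F}'=\{A\cap T : A\in\mathcal{F}\}$ be the projection of $\mathcal{F}$ onto $T$. Then $\ell_T^-(\mathcal{F}') \ge \frac{t+1}{n+1}\,\ell(\mathcal{F})$.
   Context: $[n]=\{1,\dots,n\}$ and $\ell(\mathcal{F})=\sum_{A\in\mathcal{F}}1/\binom{n}{|A|}$, the expected number of sets of $\mathcal{F}$ on a uniformly random maximal chain of $2^{[n]}$. For $T\subseteq[n]$ and a family $\mathcal{G}$, $\ell_T^-(\mathcal{G})$ is the expected number of sets of $\mathcal{G}$ on a uniformly random maximal chain from $\emptyset$ to $T$; for $\mathcal{G}\subseteq 2^T$ this equals $\sum_{B\in\mathcal{G}}1/\binom{t}{|B|}$. -}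

module Defs where

open import Data.Bool using (Bool; true; false; if_then_else_; _∧_)
import Data.Bool as Bool
open import Data.Nat using (ℕ; zero; suc)
open import Data.Nat.Combinatorics using (_C_)
open import Data.Integer using (+_)
open import Data.Rational using (ℚ; 0ℚ; _/_; _+_)
open import Data.List using (List; []; _∷_; [_]; map; _++_; foldr)
open import Data.Bool.ListAction using (any)
open import Data.Vec using ([]; _∷_)
open import Data.Vec.Properties using (≡-dec)
open import Data.Fin.Subset using (Subset; inside; outside; _∩_; ∣_∣)
open import Relation.Nullary.Decidable using (isYes)

allSubsets : (n : ℕ) → List (Subset n)
allSubsets zero    = [ [] ]
allSubsets (suc n) = map (outside ∷_) (allSubsets n) ++ map (inside ∷_) (allSubsets n)

_==ˢ_ : {n : ℕ} → Subset n → Subset n → Bool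
p ==ˢ q = isYes (≡-dec Bool._≟_ p q)

_⊆ᵇ_ : {n : ℕ} → Subset n → Subset n → Bool
B ⊆ᵇ T = (B ∩ T) ==ˢ B

Family : ℕ → Set
Family n = Subset n → Bool

-- 1/c as a rational (only ever applied to nonzero binomial coefficients C(m,k), k ≤ m)
recip : ℕ → ℚ
recip zero    = 0ℚ
recip (suc c) = (+ 1) / suc c

sumℚ : List ℚ → ℚ
sumℚ = foldr _+_ 0ℚ

lubell : {n : ℕ} → Family n → ℚ
lubell {n} F = sumℚ (map (λ A → if F A then recip (n C ∣ A ∣) else 0ℚ) (allSubsets n))

-- ℓ_T^-(G): expected number of sets of G on a random maximal chain from ∅ to T,
-- i.e. Σ_{B ∈ G, B ⊆ T} 1 / C(|T|,|B|)
lubellBelow : {n : ℕ} → Subset n → Family n → ℚ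
lubellBelow {n} T G =
  sumℚ (map (λ B → if G B ∧ (B ⊆ᵇ T) then recip (∣ T ∣ C ∣ B ∣) else 0ℚ) (allSubsets n))

project : {n : ℕ} → Subset n → Family n → Family n
project {n} T F B = any (λ A → F A ∧ ((A ∩ T) ==ˢ B)) (allSubsets n)

module Submission where

-- Write 1/C(N,k) = (N+1) · β k (N-k) with the Beta weight
-- β k m = k! m! / (k+m+1)! = 1 / ((k+m+1) · C(k+m,k)).  β satisfies the
-- Pascal rule β k m = β (k+1) m + β k (m+1).
-- For any weight with the Pascal rule, summing w(|A|, |∁A|) over all A ⊆ [n] with
-- A ∩ T = B gives w(|B|, |T ∖ B|): adding one coordinate outside T merges the two
-- extensions of A via the Pascal rule, a coordinate inside T just shifts the weight.
-- Hence, for every family G, the pull-back {A : A ∩ T ∈ G} has Lubell mass exactly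
-- (n+1)/(t+1) · ℓ_T^-(G).  Since every A ∈ F lies in the pull-back of F', the theorem
-- follows by monotonicity.

open import Defs
open import Algebra.Bundles using (CommutativeMonoid)
open import Data.Bool using (Bool; true; false; if_then_else_; _∧_) renaming (T to Holds)
import Data.Bool as Bool
open import Data.Bool.Properties using (∧-identityʳ; ∧-zeroʳ; T-∧)
open import Data.Empty using (⊥-elim)
open import Data.Fin.Subset using (Subset; inside; outside; _∩_; _─_; ∁; ∣_∣)
open import Data.Fin.Subset.Properties using (∣p∣≤n; ∣∁p∣≡n∸∣p∣)
open import Data.Integer as ℤ using (+_)
import Data.Integer.Properties as ℤP
open import Data.List using (List; []; _∷_; map; _++_)
open import Data.List.Membership.Propositional using (_∈_; lose)
open import Data.List.Membership.Propositional.Properties using (∈-map⁺; ∈-++⁺ˡ; ∈-++⁺ʳ)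
import Data.List.Properties as ListP
open import Data.List.Relation.Unary.Any using (here)
open import Data.List.Relation.Unary.Any.Properties using (any⁺)
open import Data.Nat as ℕ using (ℕ; zero; suc; NonZero; _!)
open import Data.Nat.Combinatorics using (_C_; nCk≡n!/k![n-k]!; k![n∸k]!∣n!)
open import Data.Nat.DivMod using (m/n*n≡m)
import Data.Nat.Properties as ℕP
open import Data.Nat.Tactic.RingSolver using (solve-∀)
open import Data.Product using (_,_; proj₂)
open import Data.Rational using (ℚ; 0ℚ; _/_; _+_; _*_; _≤_; toℚᵘ)
import Data.Rational.Properties as ℚP
open import Data.Rational.Unnormalised as ℚᵘ using (mkℚᵘ; *≡*) renaming (_≃_ to _≃ᵘ_)
import Data.Rational.Unnormalised.Properties as ℚᵘP
open import Data.Unit using (tt)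
open import Data.Vec using ([]; _∷_)
open import Data.Vec.Properties using (≡-dec)
open import Function using (Equivalence)
open import Relation.Binary.PropositionalEquality
open import Relation.Nullary.Decidable using (isYes; isYes≗does; fromWitness)

open import Algebra.Properties.CommutativeSemigroup
  (CommutativeMonoid.commutativeSemigroup ℚP.+-0-commutativeMonoid) using (interchange)

toℚᵘ-frac : ∀ a b → toℚᵘ (+ a / suc b) ≃ᵘ mkℚᵘ (+ a) b
toℚᵘ-frac a b = ℚP.toℚᵘ-fromℚᵘ (mkℚᵘ (+ a) b)

frac-≡ : ∀ a b c d .{{_ : NonZero b}} .{{_ : NonZero d}} →
         a ℕ.* d ≡ c ℕ.* b → + a / b ≡ + c / d
frac-≡ a (suc b) c (suc d) ad≡cb = ℚP.toℚᵘ-injective (begin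
    toℚᵘ (+ a / suc b) ≈⟨ toℚᵘ-frac a b ⟩
    mkℚᵘ (+ a) b       ≈⟨ *≡* cross ⟩
    mkℚᵘ (+ c) d       ≈⟨ ℚᵘP.≃-sym (toℚᵘ-frac c d) ⟩
    toℚᵘ (+ c / suc d) ∎)
  where
  open ℚᵘP.≃-Reasoning
  cross : + a ℤ.* + suc d ≡ + c ℤ.* + suc b
  cross = trans (sym (ℤP.pos-* a (suc d))) (trans (cong +_ ad≡cb) (ℤP.pos-* c (suc b)))

frac-+ : ∀ a b c d .{{_ : NonZero b}} .{{_ : NonZero d}} →
         + a / b + + c / d ≡ (+ (a ℕ.* d ℕ.+ c ℕ.* b) / (b ℕ.* d)) {{ℕP.m*n≢0 b d}}
frac-+ a (suc b) c (suc d) = ℚP.toℚᵘ-injective (begin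
    toℚᵘ (+ a / suc b + + c / suc d)
      ≈⟨ ℚP.toℚᵘ-homo-+ (+ a / suc b) (+ c / suc d) ⟩
    toℚᵘ (+ a / suc b) ℚᵘ.+ toℚᵘ (+ c / suc d)
      ≈⟨ ℚᵘP.+-cong (toℚᵘ-frac a b) (toℚᵘ-frac c d) ⟩
    mkℚᵘ (+ a) b ℚᵘ.+ mkℚᵘ (+ c) d
      ≈⟨ ℚᵘP.≃-reflexive (cong (λ z → mkℚᵘ z (d ℕ.+ b ℕ.* suc d)) numerator) ⟩
    mkℚᵘ (+ (a ℕ.* suc d ℕ.+ c ℕ.* suc b)) (d ℕ.+ b ℕ.* suc d)
      ≈⟨ ℚᵘP.≃-sym (toℚᵘ-frac (a ℕ.* suc d ℕ.+ c ℕ.* suc b) (d ℕ.+ b ℕ.* suc d)) ⟩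
    toℚᵘ (+ (a ℕ.* suc d ℕ.+ c ℕ.* suc b) / (suc b ℕ.* suc d)) ∎)
  where
  open ℚᵘP.≃-Reasoning
  numerator : + a ℤ.* + suc d ℤ.+ + c ℤ.* + suc b ≡ + (a ℕ.* suc d ℕ.+ c ℕ.* suc b)
  numerator = sym (trans (ℤP.pos-+ (a ℕ.* suc d) (c ℕ.* suc b))
                         (cong₂ ℤ._+_ (ℤP.pos-* a (suc d)) (ℤP.pos-* c (suc b))))

frac-* : ∀ a b c d .{{_ : NonZero b}} .{{_ : NonZero d}} →
         (+ a / b) * (+ c / d) ≡ (+ (a ℕ.* c) / (b ℕ.* d)) {{ℕP.m*n≢0 b d}}
frac-* a (suc b) c (suc d) = ℚP.toℚᵘ-injective (begin
    toℚᵘ ((+ a / suc b) * (+ c / suc d))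
      ≈⟨ ℚP.toℚᵘ-homo-* (+ a / suc b) (+ c / suc d) ⟩
    toℚᵘ (+ a / suc b) ℚᵘ.* toℚᵘ (+ c / suc d)
      ≈⟨ ℚᵘP.*-cong (toℚᵘ-frac a b) (toℚᵘ-frac c d) ⟩
    mkℚᵘ (+ a) b ℚᵘ.* mkℚᵘ (+ c) d
      ≈⟨ ℚᵘP.≃-reflexive (cong (λ z → mkℚᵘ z (d ℕ.+ b ℕ.* suc d)) (sym (ℤP.pos-* a c))) ⟩
    mkℚᵘ (+ (a ℕ.* c)) (d ℕ.+ b ℕ.* suc d)
      ≈⟨ ℚᵘP.≃-sym (toℚᵘ-frac (a ℕ.* c) (d ℕ.+ b ℕ.* suc d)) ⟩
    toℚᵘ (+ (a ℕ.* c) / (suc b ℕ.* suc d)) ∎)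
  where open ℚᵘP.≃-Reasoning

rescale : ∀ t n x → (+ suc t / suc n) * ((+ suc n / 1) * x) ≡ (+ suc t / 1) * x
rescale t n x = trans (sym (ℚP.*-assoc (+ suc t / suc n) (+ suc n / 1) x))
  (cong (_* x) (trans (frac-* (suc t) (suc n) (suc n) 1)
                      (frac-≡ (suc t ℕ.* suc n) (suc n ℕ.* 1) (suc t) 1
                              (ℕP.*-assoc (suc t) (suc n) 1))))

β : ℕ → ℕ → ℚ
β k m = (+ (k ! ℕ.* m !) / suc (k ℕ.+ m) !) {{suc (k ℕ.+ m) ℕP.!≢0}}

-- The polynomial identity behind the Pascal rule, with (k+m+1)! abstracted as F.
pascal-cross : ∀ k m p q F →
  ((suc k ℕ.* p) ℕ.* q ℕ.* (suc (suc (k ℕ.+ m)) ℕ.* F)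
     ℕ.+ (p ℕ.* (suc m ℕ.* q)) ℕ.* (suc (suc (k ℕ.+ m)) ℕ.* F)) ℕ.* F
  ≡ (p ℕ.* q) ℕ.* ((suc (suc (k ℕ.+ m)) ℕ.* F) ℕ.* (suc (suc (k ℕ.+ m)) ℕ.* F))
pascal-cross = solve-∀

-- Pascal rule for β: k! m! (k+m+2) = (k+1)! m! + k! (m+1)!, divided by (k+m+2)!.
β-pascal : ∀ k m → β k m ≡ β (suc k) m + β k (suc m)
β-pascal k m = sym (begin
    β (suc k) m + β k (suc m)
      ≡⟨ frac-+ X D₁ Y D₂ {{D₁≢0}} {{D₂≢0}} ⟩
    (+ (X ℕ.* D₂ ℕ.+ Y ℕ.* D₁) / (D₁ ℕ.* D₂)) {{D₁D₂≢0}}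
      ≡⟨ frac-≡ (X ℕ.* D₂ ℕ.+ Y ℕ.* D₁) (D₁ ℕ.* D₂) (k ! ℕ.* m !) (suc (k ℕ.+ m) !)
                {{D₁D₂≢0}} {{suc (k ℕ.+ m) ℕP.!≢0}} cross ⟩
    β k m ∎)
  where
  open ≡-Reasoning
  X Y D₁ D₂ : ℕ
  X  = suc k ! ℕ.* m !
  Y  = k ! ℕ.* suc m !
  D₁ = suc (suc k ℕ.+ m) !
  D₂ = suc (k ℕ.+ suc m) !
  D₁≢0 : NonZero D₁
  D₁≢0 = suc (suc k ℕ.+ m) ℕP.!≢0
  D₂≢0 : NonZero D₂
  D₂≢0 = suc (k ℕ.+ suc m) ℕP.!≢0
  D₁D₂≢0 : NonZero (D₁ ℕ.* D₂)
  D₁D₂≢0 = ℕP.m*n≢0 D₁ D₂ {{D₁≢0}} {{D₂≢0}}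
  cross : (X ℕ.* D₂ ℕ.+ Y ℕ.* D₁) ℕ.* suc (k ℕ.+ m) ! ≡ (k ! ℕ.* m !) ℕ.* (D₁ ℕ.* D₂)
  cross rewrite ℕP.+-suc k m = pascal-cross k m (k !) (m !) (suc (k ℕ.+ m) !)

binomial-factorials : ∀ k m → ((k ℕ.+ m) C k) ℕ.* (k ! ℕ.* m !) ≡ (k ℕ.+ m) !
binomial-factorials k m =
  subst (λ j → (N C k) ℕ.* (k ! ℕ.* j !) ≡ N !) (ℕP.m+n∸m≡n k m)
    (trans (cong (ℕ._* (k ! ℕ.* (N ℕ.∸ k) !)) (nCk≡n!/k![n-k]! k≤N))
           (m/n*n≡m {{k ℕP.!* N ℕ.∸ k !≢0}} (k![n∸k]!∣n! k≤N)))
  where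
  N : ℕ
  N = k ℕ.+ m
  k≤N : k ℕ.≤ N
  k≤N = ℕP.m≤m+n k m

-- The identity cross-multiplied in recip-binomial, with k! m! abstracted as P.
recip-cross : ∀ N c P → suc N ℕ.* P ℕ.* suc c ≡ 1 ℕ.* (1 ℕ.* (suc N ℕ.* (suc c ℕ.* P)))
recip-cross = solve-∀

recip-binomial : ∀ k m {N} → k ℕ.+ m ≡ N → recip (N C k) ≡ (+ suc N / 1) * β k m
recip-binomial k m refl = from-factorials ((k ℕ.+ m) C k) (binomial-factorials k m)
  where
  N : ℕ
  N = k ℕ.+ m
  from-factorials : ∀ c → c ℕ.* (k ! ℕ.* m !) ≡ N ! → recip c ≡ (+ suc N / 1) * β k m
  from-factorials zero    c·P≡N! = ⊥-elim (ℕP.<⇒≢ (ℕP.1≤n! N) c·P≡N!)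
  from-factorials (suc c) c·P≡N! = sym (begin
      (+ suc N / 1) * β k m
        ≡⟨ frac-* (suc N) 1 (k ! ℕ.* m !) (suc N !) {{_}} {{suc N ℕP.!≢0}} ⟩
      (+ (suc N ℕ.* (k ! ℕ.* m !)) / (1 ℕ.* suc N !)) {{1·[N+1]!≢0}}
        ≡⟨ frac-≡ (suc N ℕ.* (k ! ℕ.* m !)) (1 ℕ.* suc N !) 1 (suc c) {{1·[N+1]!≢0}} cross ⟩
      recip (suc c) ∎)
    where
    open ≡-Reasoning
    1·[N+1]!≢0 : NonZero (1 ℕ.* suc N !)
    1·[N+1]!≢0 = ℕP.m*n≢0 1 (suc N !) {{_}} {{suc N ℕP.!≢0}}
    cross : suc N ℕ.* (k ! ℕ.* m !) ℕ.* suc c ≡ 1 ℕ.* (1 ℕ.* suc N !)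
    cross = trans (recip-cross N c (k ! ℕ.* m !))
                  (cong (λ x → 1 ℕ.* (1 ℕ.* (suc N ℕ.* x))) c·P≡N!)

recip-nonNeg : ∀ c → 0ℚ ≤ recip c
recip-nonNeg zero    = ℚP.≤-refl
recip-nonNeg (suc c) = ℚP.nonNegative⁻¹ (+ 1 / suc c) {{ℚP.normalize-nonNeg 1 (suc c)}}

Σˢ : (n : ℕ) → (Subset n → ℚ) → ℚ
Σˢ zero    f = f []
Σˢ (suc n) f = Σˢ n (λ A → f (outside ∷ A)) + Σˢ n (λ A → f (inside ∷ A))

sumℚ-++ : ∀ xs ys → sumℚ (xs ++ ys) ≡ sumℚ xs + sumℚ ys
sumℚ-++ []       ys = sym (ℚP.+-identityˡ (sumℚ ys))
sumℚ-++ (x ∷ xs) ys =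
  trans (cong (λ s → x + s) (sumℚ-++ xs ys)) (sym (ℚP.+-assoc x (sumℚ xs) (sumℚ ys)))

sumℚ-allSubsets : ∀ n (f : Subset n → ℚ) → sumℚ (map f (allSubsets n)) ≡ Σˢ n f
sumℚ-allSubsets zero    f = ℚP.+-identityʳ (f [])
sumℚ-allSubsets (suc n) f = begin
    sumℚ (map f (map (outside ∷_) L ++ map (inside ∷_) L))
      ≡⟨ cong sumℚ (ListP.map-++ f (map (outside ∷_) L) (map (inside ∷_) L)) ⟩
    sumℚ (map f (map (outside ∷_) L) ++ map f (map (inside ∷_) L))
      ≡⟨ sumℚ-++ (map f (map (outside ∷_) L)) (map f (map (inside ∷_) L)) ⟩
    sumℚ (map f (map (outside ∷_) L)) + sumℚ (map f (map (inside ∷_) L))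
      ≡⟨ cong₂ _+_ (half (outside ∷_)) (half (inside ∷_)) ⟩
    Σˢ (suc n) f ∎
  where
  open ≡-Reasoning
  L : List (Subset n)
  L = allSubsets n
  half : (g : Subset n → Subset (suc n)) → sumℚ (map f (map g L)) ≡ Σˢ n (λ A → f (g A))
  half g = trans (cong sumℚ (sym (ListP.map-∘ L))) (sumℚ-allSubsets n (λ A → f (g A)))

Σˢ-cong : ∀ n {f g : Subset n → ℚ} → (∀ A → f A ≡ g A) → Σˢ n f ≡ Σˢ n g
Σˢ-cong zero    f≗g = f≗g []
Σˢ-cong (suc n) f≗g = cong₂ _+_ (Σˢ-cong n (λ A → f≗g _)) (Σˢ-cong n (λ A → f≗g _))

Σˢ-mono : ∀ n {f g : Subset n → ℚ} → (∀ A → f A ≤ g A) → Σˢ n f ≤ Σˢ n g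
Σˢ-mono zero    f≤g = f≤g []
Σˢ-mono (suc n) f≤g = ℚP.+-mono-≤ (Σˢ-mono n (λ A → f≤g _)) (Σˢ-mono n (λ A → f≤g _))

Σˢ-+ : ∀ n (f g : Subset n → ℚ) → Σˢ n f + Σˢ n g ≡ Σˢ n (λ A → f A + g A)
Σˢ-+ zero    f g = refl
Σˢ-+ (suc n) f g =
  trans (interchange (Σˢ n (λ A → f (outside ∷ A))) (Σˢ n (λ A → f (inside ∷ A)))
                     (Σˢ n (λ A → g (outside ∷ A))) (Σˢ n (λ A → g (inside ∷ A))))
        (cong₂ _+_ (Σˢ-+ n _ _) (Σˢ-+ n _ _))

Σˢ-* : ∀ n c (f : Subset n → ℚ) → c * Σˢ n f ≡ Σˢ n (λ A → c * f A)
Σˢ-* zero    c f = refl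
Σˢ-* (suc n) c f = trans (ℚP.*-distribˡ-+ c _ _) (cong₂ _+_ (Σˢ-* n c _) (Σˢ-* n c _))

Σˢ-0 : ∀ n → Σˢ n (λ _ → 0ℚ) ≡ 0ℚ
Σˢ-0 zero    = refl
Σˢ-0 (suc n) = cong₂ _+_ (Σˢ-0 n) (Σˢ-0 n)

when : Bool → ℚ → ℚ
when b x = if b then x else 0ℚ

when-+ : ∀ b x y → when b x + when b y ≡ when b (x + y)
when-+ true  x y = refl
when-+ false x y = ℚP.+-identityˡ 0ℚ

when-* : ∀ b c x → when b (c * x) ≡ c * when b x
when-* true  c x = refl
when-* false c x = sym (ℚP.*-zeroʳ c)

when-cong : ∀ b {x y} → (Holds b → x ≡ y) → when b x ≡ when b y
when-cong true  x≡y = x≡y tt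
when-cong false _   = refl

when-mono : ∀ {b b′ x} → (Holds b → Holds b′) → 0ℚ ≤ x → when b x ≤ when b′ x
when-mono {false} {false} _    _   = ℚP.≤-refl
when-mono {false} {true}  _    0≤x = 0≤x
when-mono {true}  {true}  _    _   = ℚP.≤-refl
when-mono {true}  {false} b⇒b′ _   = ⊥-elim (b⇒b′ tt)

⊆ᵇ-∷ : ∀ {n} h x (B T : Subset n) →
       ((h ∷ B) ⊆ᵇ (x ∷ T)) ≡ isYes ((h ∧ x) Bool.≟ h) ∧ (B ⊆ᵇ T)
⊆ᵇ-∷ h x B T = trans (isYes≗does (≡-dec Bool._≟_ ((h ∷ B) ∩ (x ∷ T)) (h ∷ B)))
  (cong₂ _∧_ (sym (isYes≗does ((h ∧ x) Bool.≟ h)))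
             (sym (isYes≗does (≡-dec Bool._≟_ (B ∩ T) B))))

size-complement : ∀ {n} (A : Subset n) → ∣ A ∣ ℕ.+ ∣ ∁ A ∣ ≡ n
size-complement A = trans (cong (∣ A ∣ ℕ.+_) (∣∁p∣≡n∸∣p∣ A)) (ℕP.m+[n∸m]≡n (∣p∣≤n A))

size-difference : ∀ {n} (T B : Subset n) → Holds (B ⊆ᵇ T) → ∣ B ∣ ℕ.+ ∣ T ─ B ∣ ≡ ∣ T ∣
size-difference []            []            B⊆T = refl
size-difference (inside ∷ T)  (inside ∷ B)  B⊆T =
  cong suc (size-difference T B (subst Holds (⊆ᵇ-∷ inside inside B T) B⊆T))
size-difference (inside ∷ T)  (outside ∷ B) B⊆T =
  trans (ℕP.+-suc ∣ B ∣ ∣ T ─ B ∣)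
        (cong suc (size-difference T B (subst Holds (⊆ᵇ-∷ outside inside B T) B⊆T)))
size-difference (outside ∷ T) (outside ∷ B) B⊆T =
  size-difference T B (subst Holds (⊆ᵇ-∷ outside outside B T) B⊆T)
size-difference (outside ∷ T) (inside ∷ B)  B⊆T =
  ⊥-elim (subst Holds (⊆ᵇ-∷ inside outside B T) B⊆T)

∈-allSubsets : ∀ {n} (A : Subset n) → A ∈ allSubsets n
∈-allSubsets []                    = here refl
∈-allSubsets {suc n} (outside ∷ A) = ∈-++⁺ˡ (∈-map⁺ (outside ∷_) (∈-allSubsets A))
∈-allSubsets {suc n} (inside ∷ A)  =
  ∈-++⁺ʳ (map (outside ∷_) (allSubsets n)) (∈-map⁺ (inside ∷_) (∈-allSubsets A))

project-∩ : ∀ {n} (T : Subset n) (F : Family n) A → Holds (F A) → Holds (project T F (A ∩ T))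
project-∩ T F A A∈F = any⁺ (λ A′ → F A′ ∧ ((A′ ∩ T) ==ˢ (A ∩ T)))
  (lose (∈-allSubsets A) (Equivalence.from T-∧ (A∈F , fromWitness refl)))

Pascal : (ℕ → ℕ → ℚ) → Set
Pascal w = ∀ k m → w k m ≡ w (suc k) m + w k (suc m)

-- Induction on n: a coordinate outside T merges the two
-- extensions of A (Pascal rule), one inside T shifts the weight, which keeps it
-- Pascal.
fibre-sum : ∀ n (w : ℕ → ℕ → ℚ) → Pascal w → (T : Subset n) (G : Family n) →
  Σˢ n (λ A → when (G (A ∩ T)) (w ∣ A ∣ ∣ ∁ A ∣))
    ≡ Σˢ n (λ B → when (G B ∧ (B ⊆ᵇ T)) (w ∣ B ∣ ∣ T ─ B ∣))
fibre-sum zero w pascal [] G = cong (λ b → when b (w 0 0)) (sym (∧-identityʳ (G [])))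
fibre-sum (suc n) w pascal (outside ∷ T) G = begin
    Σˢ n (λ A → when (G₀ (A ∩ T)) (w ∣ A ∣ (suc ∣ ∁ A ∣)))
      + Σˢ n (λ A → when (G₀ (A ∩ T)) (w (suc ∣ A ∣) ∣ ∁ A ∣))
      ≡⟨ Σˢ-+ n _ _ ⟩
    Σˢ n (λ A → when (G₀ (A ∩ T)) (w ∣ A ∣ (suc ∣ ∁ A ∣))
                 + when (G₀ (A ∩ T)) (w (suc ∣ A ∣) ∣ ∁ A ∣))
      ≡⟨ Σˢ-cong n merge ⟩
    Σˢ n (λ A → when (G₀ (A ∩ T)) (w ∣ A ∣ ∣ ∁ A ∣))
      ≡⟨ fibre-sum n w pascal T G₀ ⟩
    Σˢ n (λ B → when (G₀ B ∧ (B ⊆ᵇ T)) (w ∣ B ∣ ∣ T ─ B ∣))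
      ≡⟨ sym (ℚP.+-identityʳ _) ⟩
    Σˢ n (λ B → when (G₀ B ∧ (B ⊆ᵇ T)) (w ∣ B ∣ ∣ T ─ B ∣)) + 0ℚ
      ≡⟨ cong₂ _+_ (Σˢ-cong n kept) (sym (trans (Σˢ-cong n dropped) (Σˢ-0 n))) ⟩
    Σˢ (suc n) (λ B → when (G B ∧ (B ⊆ᵇ (outside ∷ T))) (w ∣ B ∣ ∣ (outside ∷ T) ─ B ∣)) ∎
  where
  open ≡-Reasoning
  G₀ : Family n
  G₀ B = G (outside ∷ B)
  merge : ∀ A → when (G₀ (A ∩ T)) (w ∣ A ∣ (suc ∣ ∁ A ∣)) + when (G₀ (A ∩ T)) (w (suc ∣ A ∣) ∣ ∁ A ∣)
                ≡ when (G₀ (A ∩ T)) (w ∣ A ∣ ∣ ∁ A ∣)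
  merge A = trans (when-+ (G₀ (A ∩ T)) (w ∣ A ∣ (suc ∣ ∁ A ∣)) (w (suc ∣ A ∣) ∣ ∁ A ∣))
    (cong (when (G₀ (A ∩ T)))
          (trans (ℚP.+-comm (w ∣ A ∣ (suc ∣ ∁ A ∣)) (w (suc ∣ A ∣) ∣ ∁ A ∣))
                 (sym (pascal ∣ A ∣ ∣ ∁ A ∣))))
  kept : ∀ B → when (G₀ B ∧ (B ⊆ᵇ T)) (w ∣ B ∣ ∣ T ─ B ∣)
               ≡ when (G₀ B ∧ ((outside ∷ B) ⊆ᵇ (outside ∷ T))) (w ∣ B ∣ ∣ T ─ B ∣)
  kept B = cong (λ b → when (G₀ B ∧ b) (w ∣ B ∣ ∣ T ─ B ∣)) (sym (⊆ᵇ-∷ outside outside B T))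
  dropped : ∀ B → when (G (inside ∷ B) ∧ ((inside ∷ B) ⊆ᵇ (outside ∷ T))) (w (suc ∣ B ∣) ∣ T ─ B ∣)
                  ≡ 0ℚ
  dropped B = cong (λ b → when b (w (suc ∣ B ∣) ∣ T ─ B ∣))
    (trans (cong (G (inside ∷ B) ∧_) (⊆ᵇ-∷ inside outside B T)) (∧-zeroʳ (G (inside ∷ B))))
fibre-sum (suc n) w pascal (inside ∷ T) G = cong₂ _+_
  (trans (fibre-sum n (λ k m → w k (suc m)) (λ k m → pascal k (suc m)) T (λ B → G (outside ∷ B)))
         (Σˢ-cong n (λ B → cong (λ b → when (G (outside ∷ B) ∧ b) (w ∣ B ∣ (suc ∣ T ─ B ∣)))
                                (sym (⊆ᵇ-∷ outside inside B T)))))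
  (trans (fibre-sum n (λ k m → w (suc k) m) (λ k m → pascal (suc k) m) T (λ B → G (inside ∷ B)))
         (Σˢ-cong n (λ B → cong (λ b → when (G (inside ∷ B) ∧ b) (w (suc ∣ B ∣) ∣ T ─ B ∣))
                                (sym (⊆ᵇ-∷ inside inside B T)))))

pullback-lubell : ∀ n (T : Subset n) (G : Family n) →
  (+ suc ∣ T ∣ / suc n) * Σˢ n (λ A → when (G (A ∩ T)) (recip (n C ∣ A ∣)))
    ≡ Σˢ n (λ B → when (G B ∧ (B ⊆ᵇ T)) (recip (∣ T ∣ C ∣ B ∣)))
pullback-lubell n T G = begin
    c * Σˢ n (λ A → when (G (A ∩ T)) (recip (n C ∣ A ∣)))
      ≡⟨ cong (c *_) (Σˢ-cong n to-β-ambient) ⟩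
    c * Σˢ n (λ A → n+1 * when (G (A ∩ T)) (β ∣ A ∣ ∣ ∁ A ∣))
      ≡⟨ cong (c *_) (sym (Σˢ-* n n+1 (λ A → when (G (A ∩ T)) (β ∣ A ∣ ∣ ∁ A ∣)))) ⟩
    c * (n+1 * Σˢ n (λ A → when (G (A ∩ T)) (β ∣ A ∣ ∣ ∁ A ∣)))
      ≡⟨ cong (λ s → c * (n+1 * s)) (fibre-sum n β β-pascal T G) ⟩
    c * (n+1 * Σˢ n (λ B → when (G B ∧ (B ⊆ᵇ T)) (β ∣ B ∣ ∣ T ─ B ∣)))
      ≡⟨ rescale ∣ T ∣ n _ ⟩
    t+1 * Σˢ n (λ B → when (G B ∧ (B ⊆ᵇ T)) (β ∣ B ∣ ∣ T ─ B ∣))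
      ≡⟨ Σˢ-* n t+1 (λ B → when (G B ∧ (B ⊆ᵇ T)) (β ∣ B ∣ ∣ T ─ B ∣)) ⟩
    Σˢ n (λ B → t+1 * when (G B ∧ (B ⊆ᵇ T)) (β ∣ B ∣ ∣ T ─ B ∣))
      ≡⟨ Σˢ-cong n from-β-local ⟩
    Σˢ n (λ B → when (G B ∧ (B ⊆ᵇ T)) (recip (∣ T ∣ C ∣ B ∣))) ∎
  where
  open ≡-Reasoning
  c n+1 t+1 : ℚ
  c   = + suc ∣ T ∣ / suc n
  n+1 = + suc n / 1
  t+1 = + suc ∣ T ∣ / 1
  to-β-ambient : ∀ A → when (G (A ∩ T)) (recip (n C ∣ A ∣))
                       ≡ n+1 * when (G (A ∩ T)) (β ∣ A ∣ ∣ ∁ A ∣)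
  to-β-ambient A =
    trans (cong (when (G (A ∩ T))) (recip-binomial ∣ A ∣ ∣ ∁ A ∣ (size-complement A)))
          (when-* (G (A ∩ T)) n+1 (β ∣ A ∣ ∣ ∁ A ∣))
  -- only sets B ⊆ T survive the guard, and for those |B| + |T ∖ B| = t.
  from-β-local : ∀ B → t+1 * when (G B ∧ (B ⊆ᵇ T)) (β ∣ B ∣ ∣ T ─ B ∣)
                       ≡ when (G B ∧ (B ⊆ᵇ T)) (recip (∣ T ∣ C ∣ B ∣))
  from-β-local B = trans (sym (when-* (G B ∧ (B ⊆ᵇ T)) t+1 (β ∣ B ∣ ∣ T ─ B ∣)))
    (when-cong (G B ∧ (B ⊆ᵇ T)) (λ GB∧B⊆T →
       sym (recip-binomial ∣ B ∣ ∣ T ─ B ∣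
             (size-difference T B (proj₂ (Equivalence.to T-∧ GB∧B⊆T))))))

-- The theorem: F lies inside the pull-back of its projection F'.

lemma3p3 : (n : ℕ) (F : Family n) (T : Subset n) →
    ((+ suc ∣ T ∣) / suc n) * lubell F ≤ lubellBelow T (project T F)
lemma3p3 n F T = begin
    c * lubell F
      ≡⟨ cong (c *_) (sumℚ-allSubsets n (λ A → when (F A) (recip (n C ∣ A ∣)))) ⟩
    c * Σˢ n (λ A → when (F A) (recip (n C ∣ A ∣)))
      ≤⟨ ℚP.*-monoˡ-≤-nonNeg c {{ℚP.normalize-nonNeg (suc ∣ T ∣) (suc n)}}
           (Σˢ-mono n (λ A → when-mono (project-∩ T F A) (recip-nonNeg (n C ∣ A ∣)))) ⟩
    c * Σˢ n (λ A → when (project T F (A ∩ T)) (recip (n C ∣ A ∣)))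
      ≡⟨ pullback-lubell n T (project T F) ⟩
    Σˢ n (λ B → when (project T F B ∧ (B ⊆ᵇ T)) (recip (∣ T ∣ C ∣ B ∣)))
      ≡⟨ sumℚ-allSubsets n _ ⟨
    lubellBelow T (project T F) ∎
  where
  open ℚP.≤-Reasoning
  c : ℚ
  c = + suc ∣ T ∣ / suc n
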